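{- Let $V$ be the polyomino consisting of the 14 tiles with centers $(1,0),(2,0),(2,1),(3,1),(3,2),(4,2),(5,2),(2,3),(3,3),(4,3),(2,4),(3,4),(4,4),(5,4)$, and let $A=(1,0)$, $B=(5,4)$, $C=(5,2)$. Then there is exactly one set of four tiles of $V$ containing $A$ such that rooks on these tiles guard all of $V$, and there is exactly one set of four tiles of $V$ containing both $B$ and $C$ such that rooks on these tiles guard all of $V$.
   Context: Tiles are unit squares identified with their centers in $\mathbb{Z}^2$. A rook on tile $p$ of a polyomino $P$ guards $p$ and, for each $e\in\{(\pm1,0),(0,\pm1)\}$, every $p+ke$ ($k\ge1$) such that $p+je$ is a tile of $P$ for all $0\le j\le k$. A set of rooks guards $P$ if every tile of $P$ is guarded by some rook. -}

module Defs where

open import Data.Integer using (ℤ; +_; -[1+_]; _+_; _*_)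
open import Data.Nat using (ℕ; _≤_)
open import Data.Product using (_×_; _,_; ∃; ∃-syntax; Σ)
open import Data.List using (List; []; _∷_; length)
open import Data.List.Membership.Propositional using (_∈_)
open import Data.List.Relation.Unary.All using (All)
open import Data.List.Relation.Unary.Any using (Any)
open import Data.List.Relation.Unary.Unique.Propositional using (Unique)
open import Relation.Binary.PropositionalEquality using (_≡_)
open import Function.Bundles using (_⇔_)

-- A tile is identified with its center in ℤ².
Tile : Set
Tile = ℤ × ℤ

Polyomino : Set
Polyomino = List Tile

Dir : Set
Dir = Tile

dirs : List Dir
dirs = (+ 1 , + 0) ∷ (-[1+ 0 ] , + 0) ∷ (+ 0 , + 1) ∷ (+ 0 , -[1+ 0 ]) ∷ []

step : Tile → ℕ → Dir → Tile
step (x , y) k (a , b) = (x + (+ k) * a , y + (+ k) * b)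

RookGuards : Polyomino → Tile → Tile → Set
RookGuards P p t =
  p ∈ P × ∃[ e ] ∃[ k ] (e ∈ dirs × (∀ j → j ≤ k → step p j e ∈ P) × t ≡ step p k e)

Guards : Polyomino → List Tile → Set
Guards P S = ∀ t → t ∈ P → Any (λ r → RookGuards P r t) S

IsTileSetOfSize : Polyomino → ℕ → List Tile → Set
IsTileSetOfSize P n S = Unique S × length S ≡ n × All (_∈ P) S

SameSet : List Tile → List Tile → Set
SameSet S T = ∀ t → (t ∈ S) ⇔ (t ∈ T)

ExactlyOneSet : (List Tile → Set) → Set
ExactlyOneSet Q = Σ (List Tile) λ S → Q S × (∀ T → Q T → SameSet T S)

V : Polyomino
V = (+ 1 , + 0) ∷ (+ 2 , + 0) ∷ (+ 2 , + 1) ∷ (+ 3 , + 1) ∷ (+ 3 , + 2) ∷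
    (+ 4 , + 2) ∷ (+ 5 , + 2) ∷ (+ 2 , + 3) ∷ (+ 3 , + 3) ∷ (+ 4 , + 3) ∷
    (+ 2 , + 4) ∷ (+ 3 , + 4) ∷ (+ 4 , + 4) ∷ (+ 5 , + 4) ∷ []

A B C : Tile
A = (+ 1 , + 0)
B = (+ 5 , + 4)
C = (+ 5 , + 2)

module Submission where

-- A rook guards a tile exactly when a straight segment of tiles joins the two, and
-- no segment in V has five tiles, so guarding is decidable by a bounded search.
-- A guarding set must meet, for every tile t, the set of tiles whose rook guards t.
-- Up to order, a set of four tiles of V is one of the 1001 four-element sublists of
-- V; checking this hitting condition on each of them shows that SA is the only one
-- containing A and SB the only one containing B and C, and SA, SB do guard V.

open import Defs
open import Data.Integer as ℤ using (+_)
open import Data.Nat as ℕ using (ℕ; zero; suc; _≤_; _<_; s≤s)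
open import Data.Nat.Properties using (allUpTo?; anyUpTo?; _<?_; ≮⇒≥; ≤-pred; suc-injective)
open import Data.Product using (_×_; _,_; ∃-syntax; proj₁)
open import Data.Product.Properties using (≡-dec)
open import Data.List using (List; []; _∷_; [_]; _++_; length; map; filter)
open import Data.List.Properties using (filter-all; filter-accept; filter-reject)
open import Data.List.Relation.Unary.Any as Any using (Any; here; there; any?)
open import Data.List.Relation.Unary.Any.Properties using (++⁺ˡ; ++⁺ʳ; map⁺)
open import Data.List.Relation.Unary.All as All using (All; []; _∷_; all?)
import Data.List.Relation.Unary.All.Properties as All
open import Data.List.Relation.Unary.AllPairs using (_∷_)
open import Data.List.Relation.Unary.Unique.Propositional using (Unique)
open import Data.List.Relation.Unary.Unique.Propositional.Properties using (filter⁺)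
open import Data.List.Membership.Propositional using (_∈_; _∉_; find; lose)
open import Data.List.Membership.Propositional.Properties using (∈-filter⁺; ∈-filter⁻)
open import Data.List.Relation.Binary.Subset.Propositional using (_⊆_)
open import Data.List.Relation.Binary.Subset.Propositional.Properties using (Any-resp-⊆)
open import Relation.Binary.Definitions using (DecidableEquality; Decidable)
open import Relation.Binary.PropositionalEquality using (_≡_; _≢_; refl; sym; trans; cong)
open import Relation.Nullary using (Dec; yes; no; ¬?; contradiction)
open import Relation.Nullary.Decidable using (_×-dec_; _→-dec_; from-yes)
import Relation.Nullary.Decidable as Dec
open import Function using (_∘_)
open import Function.Bundles using (Equivalence; _⇔_; mk⇔)
import Function.Properties.Equivalence as ⇔

subsetsOfSize : ∀ {a} {A : Set a} → ℕ → List A → List (List A)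
subsetsOfSize zero    xs       = [ [] ]
subsetsOfSize (suc k) []       = []
subsetsOfSize (suc k) (x ∷ xs) = map (x ∷_) (subsetsOfSize k xs) ++ subsetsOfSize (suc k) xs

module _ {a} {A : Set a} (_≟_ : DecidableEquality A) where

  open import Data.List.Membership.DecPropositional _≟_ using (_∈?_)

  _≢?_ : ∀ x y → Dec (x ≢ y)
  x ≢? y = ¬? (x ≟ y)

  without : A → List A → List A
  without x = filter (x ≢?_)

  length-without : ∀ {x ys} → Unique ys → x ∈ ys → length ys ≡ suc (length (without x ys))
  length-without {x} {_ ∷ ys} (x∉ys ∷ _) (here refl) =
    cong (suc ∘ length) (sym (trans (filter-reject (x ≢?_) {xs = ys} (λ x≢x → x≢x refl))
                                    (filter-all (x ≢?_) x∉ys)))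
  length-without {x} {y ∷ ys} (y∉ys ∷ u) (there x∈ys) =
    trans (cong suc (length-without u x∈ys))
          (cong (suc ∘ length) (sym (filter-accept (x ≢?_) {y} {ys} (All.lookup y∉ys x∈ys ∘ sym))))

  subsetsOfSize-complete : ∀ {k} (xs : List A) {ys} → Unique ys → ys ⊆ xs → length ys ≡ k →
                           Any (λ U → ∀ z → z ∈ ys ⇔ z ∈ U) (subsetsOfSize k xs)
  subsetsOfSize-complete {zero} xs {[]} _ _ _ = here (λ _ → mk⇔ (λ ()) (λ ()))
  subsetsOfSize-complete {suc k} [] {y ∷ ys} _ ys⊆[] _ with () ← ys⊆[] (here refl)
  subsetsOfSize-complete {suc k} (x ∷ xs) {ys} u ys⊆x∷xs |ys| with x ∈? ys
  ... | no x∉ys = ++⁺ʳ _ (subsetsOfSize-complete xs u ys⊆xs |ys|)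
    where
    ys⊆xs : ys ⊆ xs
    ys⊆xs y∈ys with ys⊆x∷xs y∈ys
    ... | here refl = contradiction y∈ys x∉ys
    ... | there y∈xs = y∈xs
  ... | yes x∈ys =
    ++⁺ˡ (map⁺ (Any.map insert (subsetsOfSize-complete xs (filter⁺ _ u) rest⊆xs |rest|)))
    where
    |rest| : length (without x ys) ≡ k
    |rest| = suc-injective (trans (sym (length-without u x∈ys)) |ys|)

    rest⊆xs : without x ys ⊆ xs
    rest⊆xs z∈rest with z∈ys , x≢z ← ∈-filter⁻ (x ≢?_) {xs = ys} z∈rest
                   with ys⊆x∷xs z∈ys
    ... | here refl = contradiction refl x≢z
    ... | there z∈xs = z∈xs

    insert : ∀ {U} → (∀ z → z ∈ without x ys ⇔ z ∈ U) → ∀ z → z ∈ ys ⇔ z ∈ x ∷ U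
    insert rest≈U z = mk⇔ to from
      where
      to : z ∈ ys → z ∈ x ∷ _
      to z∈ys with x ≟ z
      ... | yes refl = here refl
      ... | no x≢z  = there (Equivalence.to (rest≈U z) (∈-filter⁺ (x ≢?_) z∈ys x≢z))
      from : z ∈ x ∷ _ → z ∈ ys
      from (here refl) = x∈ys
      from (there z∈U) = proj₁ (∈-filter⁻ (x ≢?_) {xs = ys} (Equivalence.from (rest≈U z) z∈U))

_≟ᵗ_ : DecidableEquality Tile
_≟ᵗ_ = ≡-dec ℤ._≟_ ℤ._≟_

open import Data.List.Membership.DecPropositional _≟ᵗ_ using (_∈?_)
open import Data.List.Relation.Binary.Subset.DecPropositional _≟ᵗ_ using (_⊆?_)
open import Data.List.Relation.Unary.Unique.DecPropositional _≟ᵗ_ using (unique?)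

Segment : Polyomino → Tile → Dir → ℕ → Set
Segment P p e k = ∀ j → j ≤ k → step p j e ∈ P

segment? : ∀ P p e k → Dec (Segment P p e k)
segment? P p e k =
  Dec.map′ (λ h j j≤k → h (s≤s j≤k)) (λ h {j} j<1+k → h j (≤-pred j<1+k))
           (allUpTo? (λ j → step p j e ∈? P) (suc k))

NoTileAtDistance : Polyomino → ℕ → Set
NoTileAtDistance P n = ∀ {p e} → p ∈ P → e ∈ dirs → step p n e ∉ P

HittingSet : List (List Tile) → List Tile → Set
HittingSet F S = All (λ G → Any (_∈ G) S) F

hittingSet? : ∀ F S → Dec (HittingSet F S)
hittingSet? F S = all? (λ G → any? (_∈? G) S) F

sameSet? : ∀ S T → Dec (SameSet S T)
sameSet? S T = Dec.map′ fromInclusions toInclusions (S ⊆? T ×-dec T ⊆? S)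
  where
  fromInclusions : S ⊆ T × T ⊆ S → SameSet S T
  fromInclusions (S⊆T , T⊆S) t = mk⇔ S⊆T T⊆S
  toInclusions : SameSet S T → S ⊆ T × T ⊆ S
  toInclusions S≈T = (λ {t} → Equivalence.to (S≈T t)) , (λ {t} → Equivalence.from (S≈T t))

isTileSetOfSize? : ∀ P k S → Dec (IsTileSetOfSize P k S)
isTileSetOfSize? P k S = unique? S ×-dec length S ℕ.≟ k ×-dec all? (_∈? P) S

-- F is a parameter rather than fixed to the guarder sets so that, under evaluation,
-- those sets are computed once for a whole enumeration instead of once per candidate.
Forces : List (List Tile) → List Tile → List Tile → List Tile → Set
Forces F R S U = R ⊆ U → HittingSet F U → SameSet U S

forces? : ∀ F R S U → Dec (Forces F R S U)
forces? F R S U = R ⊆? U →-dec hittingSet? F U →-dec sameSet? U S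

module Guarding {P : Polyomino} {n : ℕ} (far : NoTileAtDistance P n) where

  segment-length< : ∀ {p e k} → p ∈ P → e ∈ dirs → Segment P p e k → k < n
  segment-length< {k = k} p∈P e∈dirs seg with k <? n
  ... | yes k<n = k<n
  ... | no k≮n = contradiction (seg n (≮⇒≥ k≮n)) (far p∈P e∈dirs)

  rookGuards? : Decidable (RookGuards P)
  rookGuards? p t with p ∈? P
  ... | no p∉P = no (p∉P ∘ proj₁)
  ... | yes p∈P = Dec.map′ fromAny toAny
        (any? (λ e → anyUpTo? (λ k → segment? P p e k ×-dec t ≟ᵗ step p k e) n) dirs)
    where
    ShortRay : Dir → Set
    ShortRay e = ∃[ k ] (k < n × Segment P p e k × t ≡ step p k e)

    fromAny : Any ShortRay dirs → RookGuards P p t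
    fromAny rays with e , e∈dirs , k , _ , seg , t≡ ← find rays =
      p∈P , e , k , e∈dirs , seg , t≡

    toAny : RookGuards P p t → Any ShortRay dirs
    toAny (_ , e , k , e∈dirs , seg , t≡) =
      lose e∈dirs (k , segment-length< p∈P e∈dirs seg , seg , t≡)

  guards? : ∀ S → Dec (Guards P S)
  guards? S = Dec.map′ (λ guarded _ → All.lookup guarded) (λ g → All.tabulate (g _))
                       (all? (λ t → any? (λ r → rookGuards? r t) S) P)

  guarders : Tile → List Tile
  guarders t = filter (λ r → rookGuards? r t) P

  guards⇒hittingSet : ∀ {S} → Guards P S → HittingSet (map guarders P) S
  guards⇒hittingSet guards = All.map⁺ (All.tabulate λ {t} t∈P →
    Any.map (λ r-guards → ∈-filter⁺ (λ r → rookGuards? r t) (proj₁ r-guards) r-guards)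
            (guards t t∈P))

  forces⇒unique : ∀ {k R S T} → All (Forces (map guarders P) R S) (subsetsOfSize k P) →
                  IsTileSetOfSize P k T → R ⊆ T → Guards P T → SameSet T S
  forces⇒unique {T = T} forcing (T-unique , |T| , T⊆P) R⊆T guards
    with U , U∈ , T≈U ← find (subsetsOfSize-complete _≟ᵗ_ P T-unique (All.lookup T⊆P) |T|) =
    λ t → ⇔.trans (T≈U t) (All.lookup forcing U∈ (T⊆U ∘ R⊆T) U-hits t)
    where
    T⊆U : T ⊆ U
    T⊆U {t} = Equivalence.to (T≈U t)
    U-hits : HittingSet (map guarders P) U
    U-hits = All.map (Any-resp-⊆ T⊆U) (guards⇒hittingSet guards)

noTileAtDistance-V : NoTileAtDistance V 5
noTileAtDistance-V p∈V e∈dirs = All.lookup (All.lookup noFarTiles p∈V) e∈dirs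
  where
  noFarTiles : All (λ p → All (λ e → step p 5 e ∉ V) dirs) V
  noFarTiles = from-yes (all? (λ p → all? (λ e → ¬? (step p 5 e ∈? V)) dirs) V)

open Guarding {n = 5} noTileAtDistance-V

SA SB : List Tile
SA = (+ 1 , + 0) ∷ (+ 3 , + 1) ∷ (+ 4 , + 2) ∷ (+ 2 , + 4) ∷ []
SB = (+ 2 , + 0) ∷ (+ 5 , + 2) ∷ (+ 3 , + 3) ∷ (+ 5 , + 4) ∷ []

A-forces-SA : All (Forces (map guarders V) [ A ] SA) (subsetsOfSize 4 V)
A-forces-SA = from-yes (all? (forces? (map guarders V) [ A ] SA) (subsetsOfSize 4 V))

BC-force-SB : All (Forces (map guarders V) (B ∷ C ∷ []) SB) (subsetsOfSize 4 V)
BC-force-SB = from-yes (all? (forces? (map guarders V) (B ∷ C ∷ []) SB) (subsetsOfSize 4 V))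

lemma6 : ExactlyOneSet (λ S → IsTileSetOfSize V 4 S × A ∈ S × Guards V S)
       × ExactlyOneSet (λ S → IsTileSetOfSize V 4 S × B ∈ S × C ∈ S × Guards V S)
lemma6 =
  ( SA
  , (from-yes (isTileSetOfSize? V 4 SA) , here refl , from-yes (guards? SA))
  , λ { T (T-set , A∈T , guards) →
          forces⇒unique A-forces-SA T-set (λ { (here refl) → A∈T }) guards })
  , ( SB
    , ( from-yes (isTileSetOfSize? V 4 SB) , from-yes (B ∈? SB) , from-yes (C ∈? SB)
      , from-yes (guards? SB))
    , λ { T (T-set , B∈T , C∈T , guards) →
            forces⇒unique BC-force-SB T-set
              (λ { (here refl) → B∈T ; (there (here refl)) → C∈T }) guards })
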